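{- Let $(A,\le,\odot,\rightarrow,0,1)$ be a bounded MLUB-complete residuated poset and let $B,C,D,E\in\mathcal P_+(A)$. Then: (1) $B\boxdot\{1\}=\operatorname{Max}LU(B)$ and $\{1\}\Rightarrow B=\operatorname{Min}U(B)$; (2) $B\boxdot C=C\boxdot B$; (3) if $B\le U(C)$ and $D\le U(E)$ then $B\boxdot D\le U(C\boxdot E)$; (4) $B\boxdot C\le U(D)$ if and only if $B\le C\Rightarrow D$; (5) $L(C\Rightarrow D)\boxdot C\le U(D)$ and $C\le L(C\Rightarrow D)\Rightarrow D$.
   Context: A residuated poset $(A,\le,\odot,\rightarrow,0,1)$ is a bounded poset with binary operations $\odot,\rightarrow:A\times A\to A$ such that for all $x,y,z,v\in A$: $x\odot1=x$; $x\odot y=y\odot x$; $x\odot(y\odot z)=(x\odot y)\odot z$; if $x\le v$ and $y\le z$ then $x\odot y\le v\odot z$; $x\odot y\le z$ iff $x\le y\rightarrow z$. For $X\subseteq A$: $L(X)$, $U(X)$ are the sets of lower/upper bounds, $\operatorname{Max}X,\operatorname{Min}X$ the maximal/minimal elements. MLUB-complete: for every nonempty $M\subseteq A$, every upper bound of $M$ lies above a minimal upper bound and every lower bound lies below a maximal lower bound. $\mathcal P_+(A)$ = nonempty subsets of $A$; for subsets $X,Y$, $X\le Y$ iff $x\le y$ for all $x\in X,y\in Y$. For $B,C\in\mathcal P_+(A)$: $B\boxdot C=\operatorname{Max}LU(\{b\odot c\mid b\in B,c\in C\})$ and $B\Rightarrow C=\operatorname{Min}U\big(\bigcap\{L(b\rightarrow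 d)\mid b\in B,\ d\in U(C)\}\big)$. -}

module Defs where

open import Level using (0ℓ)
open import Data.Product using (Σ; ∃; ∃-syntax; _×_; _,_)
open import Relation.Binary.PropositionalEquality using (_≡_)

Subset : Set → Set₁
Subset A = A → Set

record ResiduatedPoset : Set₁ where
  infix  4 _≤_
  infixl 7 _⊙_
  infixr 5 _⟶_
  field
    Carrier : Set
    _≤_     : Carrier → Carrier → Set
    ≤-refl    : ∀ {x} → x ≤ x
    ≤-trans   : ∀ {x y z} → x ≤ y → y ≤ z → x ≤ z
    ≤-antisym : ∀ {x y} → x ≤ y → y ≤ x → x ≡ y
    𝟘 𝟙     : Carrier
    𝟘-min   : ∀ x → 𝟘 ≤ x
    𝟙-max   : ∀ x → x ≤ 𝟙
    _⊙_     : Carrier → Carrier → Carrier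
    _⟶_     : Carrier → Carrier → Carrier
    ⊙-identityʳ : ∀ x → x ⊙ 𝟙 ≡ x
    ⊙-comm      : ∀ x y → x ⊙ y ≡ y ⊙ x
    ⊙-assoc     : ∀ x y z → x ⊙ (y ⊙ z) ≡ (x ⊙ y) ⊙ z
    ⊙-mono      : ∀ {x y z v} → x ≤ v → y ≤ z → x ⊙ y ≤ v ⊙ z
    residuation-⇒ : ∀ {x y z} → x ⊙ y ≤ z → x ≤ y ⟶ z
    residuation-⇐ : ∀ {x y z} → x ≤ y ⟶ z → x ⊙ y ≤ z

module Notions (R : ResiduatedPoset) where
  open ResiduatedPoset R

  Nonempty : Subset Carrier → Set
  Nonempty X = ∃[ x ] X x

  _≐_ : Subset Carrier → Subset Carrier → Set
  X ≐ Y = (∀ x → X x → Y x) × (∀ x → Y x → X x)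

  _≤ˢ_ : Subset Carrier → Subset Carrier → Set
  X ≤ˢ Y = ∀ x y → X x → Y y → x ≤ y

  ｛_｝ : Carrier → Subset Carrier
  ｛ a ｝ x = x ≡ a

  L : Subset Carrier → Subset Carrier
  L X x = ∀ y → X y → x ≤ y

  U : Subset Carrier → Subset Carrier
  U X x = ∀ y → X y → y ≤ x

  Max : Subset Carrier → Subset Carrier
  Max X x = X x × (∀ y → X y → x ≤ y → y ≡ x)

  Min : Subset Carrier → Subset Carrier
  Min X x = X x × (∀ y → X y → y ≤ x → y ≡ x)

  MLUB-complete : Set₁
  MLUB-complete =
    ∀ (M : Subset Carrier) → Nonempty M →
      (∀ u → U M u → ∃[ m ] (Min (U M) m × m ≤ u)) ×
      (∀ l → L M l → ∃[ m ] (Max (L M) m × l ≤ m))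

  prodSet : Subset Carrier → Subset Carrier → Subset Carrier
  prodSet B C z = ∃[ b ] ∃[ c ] (B b × C c × z ≡ b ⊙ c)

  infixl 7 _⊡_
  _⊡_ : Subset Carrier → Subset Carrier → Subset Carrier
  B ⊡ C = Max (L (U (prodSet B C)))

  -- ⋂ { L(b → d) | b ∈ B, d ∈ U(C) }  (empty intersection = A)
  ⋂L⟶ : Subset Carrier → Subset Carrier → Subset Carrier
  ⋂L⟶ B C x = ∀ b d → B b → U C d → L ｛ b ⟶ d ｝ x

  infixr 5 _⇛_
  _⇛_ : Subset Carrier → Subset Carrier → Subset Carrier
  B ⇛ C = Min (U (⋂L⟶ B C))

{-# OPTIONS --safe #-}
module Submission where

-- Everything reduces to the comparison of a set of products with a set of
-- upper bounds. By MLUB-completeness every element of L(U X) lies below a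
-- maximal one, so  B ⊡ C ≤ U D  says exactly that  b ⊙ c ≤ d  for b ∈ B,
-- c ∈ C, d ∈ U D.  Dually every upper bound of ⋂{L(c → d)} lies above a
-- minimal one, and residuation turns  b ⊙ c ≤ d  into  b ≤ c → d,  so
-- B ≤ C ⇛ D  says the same thing.  This is (4), from which (5) follows, and
-- (3) reduces in the same way to a statement about products of elements.
-- Parts (1) and (2) are the identities  x ⊙ 1 = x  and  x ⊙ y = y ⊙ x  pushed
-- through Max L U and Min U.  MLUB-completeness is only ever applied to U X,
-- which contains 1, and to ⋂{L(c → d)}, which contains 0.

open import Defs
open import Data.Product using (_×_; _,_; proj₁; proj₂; ∃-syntax)
open import Function.Base using (_∘_)
open import Function.Bundles using (_⇔_; mk⇔; Equivalence)
open import Function.Properties.Equivalence using () renaming (sym to ⇔-sym; trans to ⇔-trans)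
open import Relation.Binary.PropositionalEquality using (refl; sym; subst)

module Properties (R : ResiduatedPoset) where
  open ResiduatedPoset R
  open Notions R

  variable
    B C D E X Y Z : Subset Carrier

  -- Explicit-argument inclusion, so that  X ≐ Y  unfolds to  X ⊆ Y × Y ⊆ X.
  infix 4 _⊆_
  _⊆_ : Subset Carrier → Subset Carrier → Set
  X ⊆ Y = ∀ x → X x → Y x

  ≐-trans : X ≐ Y → Y ≐ Z → X ≐ Z
  ≐-trans (X⊆Y , Y⊆X) (Y⊆Z , Z⊆Y) = (λ x → Y⊆Z x ∘ X⊆Y x) , (λ x → Y⊆X x ∘ Z⊆Y x)

  U-antitone : X ⊆ Y → U Y ⊆ U X
  U-antitone X⊆Y u Uu x Xx = Uu x (X⊆Y x Xx)

  L-antitone : X ⊆ Y → L Y ⊆ L X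
  L-antitone X⊆Y l Ll x Xx = Ll x (X⊆Y x Xx)

  U-cong : X ≐ Y → U X ≐ U Y
  U-cong (X⊆Y , Y⊆X) = U-antitone Y⊆X , U-antitone X⊆Y

  L-cong : X ≐ Y → L X ≐ L Y
  L-cong (X⊆Y , Y⊆X) = L-antitone Y⊆X , L-antitone X⊆Y

  Max-cong : X ≐ Y → Max X ≐ Max Y
  Max-cong (X⊆Y , Y⊆X) =
      (λ x (Xx , maximal) → X⊆Y x Xx , λ y Yy → maximal y (Y⊆X y Yy))
    , (λ x (Yx , maximal) → Y⊆X x Yx , λ y Xy → maximal y (X⊆Y y Xy))

  Min-cong : X ≐ Y → Min X ≐ Min Y
  Min-cong (X⊆Y , Y⊆X) =
      (λ x (Xx , minimal) → X⊆Y x Xx , λ y Yy → minimal y (Y⊆X y Yy))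
    , (λ x (Yx , minimal) → Y⊆X x Yx , λ y Xy → minimal y (X⊆Y y Xy))

  ⊆-LU : X ⊆ L (U X)
  ⊆-LU x Xx u Uu = Uu x Xx

  U-LU : U (L (U X)) ≐ U X
  U-LU = U-antitone ⊆-LU , λ u Uu l LUl → LUl u Uu

  L-≤ˢ : L X ≤ˢ X
  L-≤ˢ l x Ll Xx = Ll x Xx

  residuation-⇒ˡ : ∀ {x y z} → x ⊙ y ≤ z → y ≤ x ⟶ z
  residuation-⇒ˡ {x} {y} {z} xy≤z = residuation-⇒ (subst (_≤ z) (⊙-comm x y) xy≤z)

  prodSet-comm : prodSet B C ⊆ prodSet C B
  prodSet-comm _ (b , c , Bb , Cc , refl) = c , b , Cc , Bb , ⊙-comm b c

  prodSet-｛𝟙｝ : prodSet B ｛ 𝟙 ｝ ≐ B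
  prodSet-｛𝟙｝ {B} =
      (λ { _ (b , _ , Bb , refl , refl) → subst B (sym (⊙-identityʳ b)) Bb })
    , (λ b Bb → b , 𝟙 , Bb , refl , sym (⊙-identityʳ b))

  ⋂L⟶-｛𝟙｝ : ⋂L⟶ ｛ 𝟙 ｝ B ≐ L (U B)
  ⋂L⟶-｛𝟙｝ =
      (λ x x≤𝟙⟶ d Ud →
         subst (_≤ d) (⊙-identityʳ x) (residuation-⇐ (x≤𝟙⟶ 𝟙 d refl Ud (𝟙 ⟶ d) refl)))
    , (λ { x LUx _ d refl Ud _ refl →
           residuation-⇒ (subst (_≤ d) (sym (⊙-identityʳ x)) (LUx d Ud)) })

  ≤ˢ-U-⋂L⟶⇔ : B ≤ˢ U (⋂L⟶ C D) ⇔ prodSet B C ≤ˢ U D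
  ≤ˢ-U-⋂L⟶⇔ {B} {C} {D} = mk⇔ to from
    where
    to : B ≤ˢ U (⋂L⟶ C D) → prodSet B C ≤ˢ U D
    to B≤U⋂ _ d (b , c , Bb , Cc , refl) Ud =
      residuation-⇐ (B≤U⋂ b (c ⟶ d) Bb λ x x∈⋂ → x∈⋂ c d Cc Ud (c ⟶ d) refl)

    from : prodSet B C ≤ˢ U D → B ≤ˢ U (⋂L⟶ C D)
    from BC≤UD b u Bb Uu =
      Uu b λ { c d Cc Ud _ refl → residuation-⇒ (BC≤UD (b ⊙ c) d (b , c , Bb , Cc , refl) Ud) }

  prodSet-≤ˢ-U-prodSet : B ≤ˢ U C → D ≤ˢ U E → prodSet B D ≤ˢ U (prodSet C E)
  prodSet-≤ˢ-U-prodSet {B} {C} {D} {E} B≤UC D≤UE _ u (b , d , Bb , Dd , refl) Uu =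
    residuation-⇐ (B≤UC b (d ⟶ u) Bb (d⟶u∈UC d Dd))
    where
    c⟶u∈UE : ∀ c → C c → U E (c ⟶ u)
    c⟶u∈UE c Cc e Ee = residuation-⇒ˡ (Uu (c ⊙ e) (c , e , Cc , Ee , refl))

    d⟶u∈UC : ∀ d → D d → U C (d ⟶ u)
    d⟶u∈UC d Dd c Cc = residuation-⇒ˡ (residuation-⇐ (D≤UE d (c ⟶ u) Dd (c⟶u∈UE c Cc)))

  ⊡-｛𝟙｝ : (B ⊡ ｛ 𝟙 ｝) ≐ Max (L (U B))
  ⊡-｛𝟙｝ = Max-cong (L-cong (U-cong prodSet-｛𝟙｝))

  ｛𝟙｝-⇛ : (｛ 𝟙 ｝ ⇛ B) ≐ Min (U B)
  ｛𝟙｝-⇛ = Min-cong (≐-trans (U-cong ⋂L⟶-｛𝟙｝) U-LU)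

  ⊡-comm : (B ⊡ C) ≐ (C ⊡ B)
  ⊡-comm = Max-cong (L-cong (U-cong (prodSet-comm , prodSet-comm)))

  module MLUB (mlub : MLUB-complete) where

    LU-below-Max : ∀ {l} → L (U X) l → ∃[ m ] (Max (L (U X)) m × l ≤ m)
    LU-below-Max {X} {l} = proj₂ (mlub (U X) (𝟙 , λ x _ → 𝟙-max x)) l

    U-Max-LU⊆U : U (Max (L (U X))) ⊆ U X
    U-Max-LU⊆U u Uu x Xx with LU-below-Max (⊆-LU x Xx)
    ... | m , Max-m , x≤m = ≤-trans x≤m (Uu m Max-m)

    Max-LU-≤ˢ⇔ : Max (L (U X)) ≤ˢ Y ⇔ X ≤ˢ Y
    Max-LU-≤ˢ⇔ = mk⇔
      (λ Max≤Y x y Xx Yy → U-Max-LU⊆U y (λ m Max-m → Max≤Y m y Max-m Yy) x Xx)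
      (λ X≤Y m y (LUm , _) Yy → LUm y (λ x Xx → X≤Y x y Xx Yy))

    ≤ˢ-Min-U⇔ : Nonempty X → Y ≤ˢ Min (U X) ⇔ Y ≤ˢ U X
    ≤ˢ-Min-U⇔ {X} {Y} X≠∅ = mk⇔
      (λ Y≤Min y u Yy Uu → let m , Min-m , m≤u = proj₁ (mlub X X≠∅) u Uu
                           in ≤-trans (Y≤Min y m Yy Min-m) m≤u)
      (λ Y≤U y m Yy (Um , _) → Y≤U y m Yy Um)

    ⊡-≤ˢ⇔ : (B ⊡ C) ≤ˢ Y ⇔ prodSet B C ≤ˢ Y
    ⊡-≤ˢ⇔ = Max-LU-≤ˢ⇔

    ≤ˢ-⇛⇔ : B ≤ˢ (C ⇛ D) ⇔ prodSet B C ≤ˢ U D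
    ≤ˢ-⇛⇔ = ⇔-trans (≤ˢ-Min-U⇔ (𝟘 , λ _ _ _ _ x _ → 𝟘-min x)) ≤ˢ-U-⋂L⟶⇔

    ⊡-⇛-residuation : (B ⊡ C) ≤ˢ U D ⇔ B ≤ˢ (C ⇛ D)
    ⊡-⇛-residuation = ⇔-trans ⊡-≤ˢ⇔ (⇔-sym ≤ˢ-⇛⇔)

    ⊡-mono : B ≤ˢ U C → D ≤ˢ U E → (B ⊡ D) ≤ˢ U (C ⊡ E)
    ⊡-mono B≤UC D≤UE = Equivalence.from ⊡-≤ˢ⇔ λ z u BDz Uu →
      prodSet-≤ˢ-U-prodSet B≤UC D≤UE z u BDz (U-Max-LU⊆U u Uu)

    modus-ponens : (L (C ⇛ D) ⊡ C) ≤ˢ U D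
    modus-ponens = Equivalence.from ⊡-⇛-residuation L-≤ˢ

    ≤ˢ-L⇛-⇛ : C ≤ˢ (L (C ⇛ D) ⇛ D)
    ≤ˢ-L⇛-⇛ = Equivalence.from ≤ˢ-⇛⇔ λ z u Pz →
      Equivalence.to ⊡-≤ˢ⇔ modus-ponens z u (prodSet-comm z Pz)

theorem7p4 : (R : ResiduatedPoset) →
    let open ResiduatedPoset R in
    let open Notions R in
    MLUB-complete →
    (B C D E : Subset Carrier) →
    Nonempty B → Nonempty C → Nonempty D → Nonempty E →
      ((B ⊡ ｛ 𝟙 ｝) ≐ Max (L (U B)) × (｛ 𝟙 ｝ ⇛ B) ≐ Min (U B))
      × (B ⊡ C) ≐ (C ⊡ B)
      × (B ≤ˢ U C → D ≤ˢ U E → (B ⊡ D) ≤ˢ U (C ⊡ E))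
      × ((B ⊡ C) ≤ˢ U D ⇔ B ≤ˢ (C ⇛ D))
      × ((L (C ⇛ D) ⊡ C) ≤ˢ U D × C ≤ˢ (L (C ⇛ D) ⇛ D))
theorem7p4 R mlub B C D E _ _ _ _ =
    (⊡-｛𝟙｝ , ｛𝟙｝-⇛)
  , ⊡-comm
  , ⊡-mono
  , ⊡-⇛-residuation
  , modus-ponens , ≤ˢ-L⇛-⇛
  where
  open Properties R
  open MLUB mlub
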